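{- Let $G$ be a graph with $\Delta(G)\le r$ and let $T\subseteq V(G)$ be a tight clique of $G$. Let $S=S_T=\bigcap_{x\in T}N(x)$ and let $R_T$ be the graph on vertex set $S$ whose edges are the pairs of distinct vertices of $S$ that are not adjacent in $G$. Then for all $x\in S$, \[ |N_G(x)\setminus (T\cup S)|\le d_{R_T}(x). \]
   Context: Graphs are finite and simple; $N(x)=N_G(x)$ is the (open) neighborhood of $x$ in $G$. A clique is a set of pairwise adjacent vertices. For a nonempty clique $C$ of $G$, its weight is $w(C)=\bigl|\bigcap_{x\in C}N(x)\bigr|$, the number of common neighbors of all vertices of $C$. When $\Delta(G)\le r$ one has $w(C)\le r+1-|C|$; a nonempty clique $C$ is called tight if $w(C)=r+1-|C|$. -}

module Defs where

open import Data.Nat using (ℕ; _≤_; _+_; _∸_)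
open import Data.Bool using (Bool; true; false; not; _∧_; _∨_)
open import Data.Fin using (Fin)
open import Data.Fin.Properties using (_≟_)
open import Data.Fin.Subset using (Subset; _∈_; _∉_; _∩_; _∪_; _─_; ∣_∣; Nonempty)
open import Data.Vec using (tabulate; lookup)
open import Data.List using (foldr; allFin)
open import Data.Product using (_×_)
open import Relation.Nullary using (¬_)
open import Relation.Nullary.Decidable using (⌊_⌋)
open import Relation.Binary.PropositionalEquality using (_≡_)

record Graph (n : ℕ) : Set where
  field
    adj    : Fin n → Fin n → Bool
    sym    : ∀ x y → adj x y ≡ adj y x
    irrefl : ∀ x → adj x x ≡ false

module _ {n : ℕ} (G : Graph n) where
  open Graph G

  N : Fin n → Subset n
  N x = tabulate (λ y → adj x y)

  MaxDegreeAtMost : ℕ → Set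
  MaxDegreeAtMost r = ∀ x → ∣ N x ∣ ≤ r

  IsClique : Subset n → Set
  IsClique C = ∀ x y → x ∈ C → y ∈ C → ¬ (x ≡ y) → adj x y ≡ true

  CommonNbhd : Subset n → Subset n
  CommonNbhd C = tabulate (λ y → foldr (λ x b → (not (lookup C x) ∨ adj x y) ∧ b) true (allFin n))

  weight : Subset n → ℕ
  weight C = ∣ CommonNbhd C ∣

  IsTight : ℕ → Subset n → Set
  IsTight r C = IsClique C × Nonempty C × (weight C ≡ r + 1 ∸ ∣ C ∣)

  RNbhd : Subset n → Fin n → Subset n
  RNbhd T x = tabulate (λ y → lookup (CommonNbhd T) y ∧ not ⌊ x ≟ y ⌋ ∧ not (adj x y))

  degR : Subset n → Fin n → ℕ
  degR T x = ∣ RNbhd T x ∣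

-- For x ∈ S the neighbourhood of x contains T (x is adjacent to all of T) and
-- S ∩ N(x), and T is disjoint from S, so |N(x) ∖ (T ∪ S)| + |T| + |S ∩ N(x)| ≤ r.
-- On the other side S ∖ N(x) consists of x itself and the R_T-neighbours of x,
-- so |S| ≤ |S ∩ N(x)| + 1 + d_{R_T}(x). Tightness says |T| + |S| = r + 1, and
-- adding the two estimates leaves |N(x) ∖ (T ∪ S)| ≤ d_{R_T}(x).
module Submission where

open import Defs
open import Data.Nat using (ℕ; suc; _+_; _∸_; _≤_)
open import Data.Nat.Properties
  using (+-suc; +-assoc; +-comm; +-identityʳ; ≤-trans; m≤m+n; m+[n∸m]≡n; +-monoˡ-≤; +-monoʳ-≤;
         +-cancelʳ-≤; module ≤-Reasoning)
open import Data.Bool using (Bool; true; false; not; _∧_; _∨_)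
open import Data.Bool.Properties using (∧-conicalˡ; ∧-conicalʳ; ¬-not)
open import Data.Fin using (Fin)
open import Data.Fin.Properties using (_≟_)
open import Data.Fin.Subset
  using (Subset; inside; outside; _∈_; _∉_; _⊆_; _∩_; _∪_; _─_; ⁅_⁆; ∣_∣; ⊥; Empty)
open import Data.Fin.Subset.Properties
  using (x∈p∩q⁺; x∈p∩q⁻; x∈p∪q⁺; x∈p∪q⁻; p─q⊆p; x∈⁅x⁆; ∣⁅x⁆∣≡1; ∣⊥∣≡0; Empty-unique;
         p⊆q⇒∣p∣≤∣q∣)
open import Data.Vec using ([]; _∷_; here; there; lookup; tabulate)
open import Data.Vec.Properties using (lookup∘tabulate; []=⇒lookup; lookup⇒[]=)
open import Data.List using (List; foldr; allFin)
open import Data.List.Relation.Unary.All as All using (All; []; _∷_)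
open import Data.List.Membership.Propositional.Properties using (∈-allFin)
open import Data.Product using (_,_; proj₁)
open import Data.Sum using (inj₁; inj₂)
open import Relation.Nullary using (¬_; yes; no; contradiction)
open import Relation.Nullary.Decidable using (⌊_⌋)
open import Relation.Binary.PropositionalEquality

private
  variable
    n : ℕ

∣p∪q∣+∣p∩q∣≡∣p∣+∣q∣ : ∀ (p q : Subset n) → ∣ p ∪ q ∣ + ∣ p ∩ q ∣ ≡ ∣ p ∣ + ∣ q ∣
∣p∪q∣+∣p∩q∣≡∣p∣+∣q∣ []            []            = refl
∣p∪q∣+∣p∩q∣≡∣p∣+∣q∣ (inside  ∷ p) (inside  ∷ q) =
  cong suc (trans (+-suc _ _) (trans (cong suc (∣p∪q∣+∣p∩q∣≡∣p∣+∣q∣ p q)) (sym (+-suc _ _))))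
∣p∪q∣+∣p∩q∣≡∣p∣+∣q∣ (inside  ∷ p) (outside ∷ q) = cong suc (∣p∪q∣+∣p∩q∣≡∣p∣+∣q∣ p q)
∣p∪q∣+∣p∩q∣≡∣p∣+∣q∣ (outside ∷ p) (inside  ∷ q) =
  trans (cong suc (∣p∪q∣+∣p∩q∣≡∣p∣+∣q∣ p q)) (sym (+-suc _ _))
∣p∪q∣+∣p∩q∣≡∣p∣+∣q∣ (outside ∷ p) (outside ∷ q) = ∣p∪q∣+∣p∩q∣≡∣p∣+∣q∣ p q

∣p∪q∣≤∣p∣+∣q∣ : ∀ (p q : Subset n) → ∣ p ∪ q ∣ ≤ ∣ p ∣ + ∣ q ∣
∣p∪q∣≤∣p∣+∣q∣ p q = subst (∣ p ∪ q ∣ ≤_) (∣p∪q∣+∣p∩q∣≡∣p∣+∣q∣ p q) (m≤m+n _ _)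

Empty[p∩q]⇒∣p∪q∣≡∣p∣+∣q∣ : ∀ (p q : Subset n) → Empty (p ∩ q) → ∣ p ∪ q ∣ ≡ ∣ p ∣ + ∣ q ∣
Empty[p∩q]⇒∣p∪q∣≡∣p∣+∣q∣ {n} p q empty = begin
  ∣ p ∪ q ∣                ≡⟨ sym (+-identityʳ _) ⟩
  ∣ p ∪ q ∣ + 0            ≡⟨ cong (λ c → ∣ p ∪ q ∣ + c) (sym (∣⊥∣≡0 n)) ⟩
  ∣ p ∪ q ∣ + ∣ ⊥ {n} ∣    ≡⟨ cong (λ c → ∣ p ∪ q ∣ + ∣ c ∣) (sym (Empty-unique empty)) ⟩
  ∣ p ∪ q ∣ + ∣ p ∩ q ∣    ≡⟨ ∣p∪q∣+∣p∩q∣≡∣p∣+∣q∣ p q ⟩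
  ∣ p ∣ + ∣ q ∣            ∎
  where open ≡-Reasoning

∣p∣≡∣p∩q∣+∣p─q∣ : ∀ (p q : Subset n) → ∣ p ∣ ≡ ∣ p ∩ q ∣ + ∣ p ─ q ∣
∣p∣≡∣p∩q∣+∣p─q∣ []            []            = refl
∣p∣≡∣p∩q∣+∣p─q∣ (inside  ∷ p) (inside  ∷ q) = cong suc (∣p∣≡∣p∩q∣+∣p─q∣ p q)
∣p∣≡∣p∩q∣+∣p─q∣ (inside  ∷ p) (outside ∷ q) =
  trans (cong suc (∣p∣≡∣p∩q∣+∣p─q∣ p q)) (sym (+-suc _ _))
∣p∣≡∣p∩q∣+∣p─q∣ (outside ∷ p) (inside  ∷ q) = ∣p∣≡∣p∩q∣+∣p─q∣ p q
∣p∣≡∣p∩q∣+∣p─q∣ (outside ∷ p) (outside ∷ q) = ∣p∣≡∣p∩q∣+∣p─q∣ p q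

x∈p─q⇒x∉q : ∀ {x} (p q : Subset n) → x ∈ p ─ q → x ∉ q
x∈p─q⇒x∉q (_ ∷ p) (outside ∷ q) here        ()
x∈p─q⇒x∉q (_ ∷ p) (_       ∷ q) (there x∈) (there x∈q) = x∈p─q⇒x∉q p q x∈ x∈q

∈tabulate⁻ : ∀ {f : Fin n → Bool} {i} → i ∈ tabulate f → f i ≡ true
∈tabulate⁻ {f = f} {i} i∈ = trans (sym (lookup∘tabulate f i)) ([]=⇒lookup i∈)

∈tabulate⁺ : ∀ {f : Fin n → Bool} {i} → f i ≡ true → i ∈ tabulate f
∈tabulate⁺ {f = f} {i} fi = lookup⇒[]= i _ (trans (lookup∘tabulate f i) fi)

foldr-∧-true⇒All : ∀ {A : Set} (P : A → Bool) (xs : List A) →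
                   foldr (λ x b → P x ∧ b) true xs ≡ true → All (λ x → P x ≡ true) xs
foldr-∧-true⇒All P List.[]       _ = []
foldr-∧-true⇒All P (x List.∷ xs) h = ∧-conicalˡ _ _ h ∷ foldr-∧-true⇒All P xs (∧-conicalʳ _ _ h)

module _ (G : Graph n) where
  open Graph G using (adj; irrefl) renaming (sym to adj-sym)

  ∉N⇒¬adj : ∀ {x y} → y ∉ N G x → adj x y ≡ false
  ∉N⇒¬adj y∉ = ¬-not (λ adjxy → y∉ (∈tabulate⁺ adjxy))

  ∈CommonNbhd⇒adj : ∀ {C y z} → y ∈ CommonNbhd G C → z ∈ C → adj z y ≡ true
  ∈CommonNbhd⇒adj {C} {y} {z} y∈ z∈C =
    subst (λ c → not c ∨ adj z y ≡ true) ([]=⇒lookup z∈C) admissible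
    where
    admissible : not (lookup C z) ∨ adj z y ≡ true
    admissible = All.lookup (foldr-∧-true⇒All _ (allFin n) (∈tabulate⁻ y∈)) (∈-allFin z)

  ∈⇒∉CommonNbhd : ∀ {C y} → y ∈ C → y ∉ CommonNbhd G C
  ∈⇒∉CommonNbhd {y = y} y∈C y∈S with () ← trans (sym (irrefl y)) (∈CommonNbhd⇒adj y∈S y∈C)

  ∈CommonNbhd⇒⊆N : ∀ {C x} → x ∈ CommonNbhd G C → C ⊆ N G x
  ∈CommonNbhd⇒⊆N {x = x} x∈S {y} y∈C =
    ∈tabulate⁺ (trans (adj-sym x y) (∈CommonNbhd⇒adj x∈S y∈C))

  ∈RNbhd⁺ : ∀ {T x y} → y ∈ CommonNbhd G T → ¬ x ≡ y → y ∉ N G x → y ∈ RNbhd G T x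
  ∈RNbhd⁺ {T} {x} {y} y∈S x≢y y∉N = ∈tabulate⁺ inR
    where
    inR : lookup (CommonNbhd G T) y ∧ not ⌊ x ≟ y ⌋ ∧ not (adj x y) ≡ true
    inR with x ≟ y
    ... | yes x≡y = contradiction x≡y x≢y
    ... | no _ rewrite []=⇒lookup y∈S | ∉N⇒¬adj y∉N = refl

  CommonNbhd─N⊆⁅x⁆∪RNbhd : ∀ T x → CommonNbhd G T ─ N G x ⊆ ⁅ x ⁆ ∪ RNbhd G T x
  CommonNbhd─N⊆⁅x⁆∪RNbhd T x {y} y∈ with x ≟ y
  ... | yes refl = x∈p∪q⁺ (inj₁ (x∈⁅x⁆ x))
  ... | no x≢y   = x∈p∪q⁺ (inj₂ (∈RNbhd⁺ {T} (p─q⊆p _ _ y∈) x≢y (x∈p─q⇒x∉q _ (N G x) y∈)))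

  ∣CommonNbhd∣≤∣CommonNbhd∩N∣+1+degR : ∀ T x →
    ∣ CommonNbhd G T ∣ ≤ ∣ CommonNbhd G T ∩ N G x ∣ + (1 + degR G T x)
  ∣CommonNbhd∣≤∣CommonNbhd∩N∣+1+degR T x = begin
    ∣ S ∣                        ≡⟨ ∣p∣≡∣p∩q∣+∣p─q∣ S (N G x) ⟩
    b + ∣ S ─ N G x ∣            ≤⟨ +-monoʳ-≤ b (p⊆q⇒∣p∣≤∣q∣ (CommonNbhd─N⊆⁅x⁆∪RNbhd T x)) ⟩
    b + ∣ ⁅ x ⁆ ∪ RNbhd G T x ∣  ≤⟨ +-monoʳ-≤ b (∣p∪q∣≤∣p∣+∣q∣ ⁅ x ⁆ (RNbhd G T x)) ⟩
    b + (∣ ⁅ x ⁆ ∣ + degR G T x) ≡⟨ cong (λ k → b + (k + degR G T x)) (∣⁅x⁆∣≡1 x) ⟩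
    b + (1 + degR G T x)         ∎
    where
    open ≤-Reasoning
    S = CommonNbhd G T
    b = ∣ S ∩ N G x ∣

  ∣N─T∪S∣+∣T∣+∣S∣≤∣N∣+1+degR : ∀ {T x} → x ∈ CommonNbhd G T →
    ∣ N G x ─ (T ∪ CommonNbhd G T) ∣ + ∣ T ∣ + ∣ CommonNbhd G T ∣ ≤ ∣ N G x ∣ + 1 + degR G T x
  ∣N─T∪S∣+∣T∣+∣S∣≤∣N∣+1+degR {T} {x} x∈S = begin
    a + t + ∣ S ∣           ≤⟨ +-monoʳ-≤ (a + t) (∣CommonNbhd∣≤∣CommonNbhd∩N∣+1+degR T x) ⟩
    a + t + (b + (1 + d))   ≡⟨ sym (+-assoc (a + t) b (1 + d)) ⟩
    a + t + b + (1 + d)     ≡⟨ cong (_+ (1 + d)) (+-assoc a t b) ⟩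
    a + (t + b) + (1 + d)   ≤⟨ +-monoˡ-≤ (1 + d) (+-monoʳ-≤ a ∣T∣+∣S∩N∣≤∣N∩[T∪S]∣) ⟩
    a + c + (1 + d)         ≡⟨ cong (_+ (1 + d)) (trans (+-comm a c) (sym (∣p∣≡∣p∩q∣+∣p─q∣ Nx (T ∪ S)))) ⟩
    ∣ Nx ∣ + (1 + d)        ≡⟨ sym (+-assoc ∣ Nx ∣ 1 d) ⟩
    ∣ Nx ∣ + 1 + d          ∎
    where
    open ≤-Reasoning
    S = CommonNbhd G T
    Nx = N G x
    a = ∣ Nx ─ (T ∪ S) ∣
    t = ∣ T ∣
    b = ∣ S ∩ Nx ∣
    c = ∣ Nx ∩ (T ∪ S) ∣
    d = degR G T x

    T∪[S∩N]⊆N∩[T∪S] : T ∪ (S ∩ Nx) ⊆ Nx ∩ (T ∪ S)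
    T∪[S∩N]⊆N∩[T∪S] y∈ with x∈p∪q⁻ T (S ∩ Nx) y∈
    ... | inj₁ y∈T   = x∈p∩q⁺ (∈CommonNbhd⇒⊆N x∈S y∈T , x∈p∪q⁺ (inj₁ y∈T))
    ... | inj₂ y∈S∩N with y∈S , y∈N ← x∈p∩q⁻ S Nx y∈S∩N = x∈p∩q⁺ (y∈N , x∈p∪q⁺ (inj₂ y∈S))

    Empty[T∩[S∩N]] : Empty (T ∩ (S ∩ Nx))
    Empty[T∩[S∩N]] (y , y∈) with y∈T , y∈S∩N ← x∈p∩q⁻ T (S ∩ Nx) y∈ =
      ∈⇒∉CommonNbhd y∈T (proj₁ (x∈p∩q⁻ S Nx y∈S∩N))

    ∣T∣+∣S∩N∣≤∣N∩[T∪S]∣ : t + b ≤ c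
    ∣T∣+∣S∩N∣≤∣N∩[T∪S]∣ =
      subst (_≤ c) (Empty[p∩q]⇒∣p∪q∣≡∣p∣+∣q∣ T (S ∩ Nx) Empty[T∩[S∩N]]) (p⊆q⇒∣p∣≤∣q∣ T∪[S∩N]⊆N∩[T∪S])

lemma4p2 : {n : ℕ} (G : Graph n) (r : ℕ) → MaxDegreeAtMost G r →
    (T : Subset n) → IsTight G r T →
    (x : Fin n) → x ∈ CommonNbhd G T →
    ∣ N G x ─ (T ∪ CommonNbhd G T) ∣ ≤ degR G T x
lemma4p2 G r Δ T (_ , _ , tight) x x∈S = +-cancelʳ-≤ (r + 1) a d (begin
  a + (r + 1)                 ≡⟨ cong (a +_) (sym (m+[n∸m]≡n t≤r+1)) ⟩
  a + (t + (r + 1 ∸ t))       ≡⟨ sym (+-assoc a t (r + 1 ∸ t)) ⟩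
  a + t + (r + 1 ∸ t)         ≡⟨ cong (a + t +_) (sym tight) ⟩
  a + t + weight G T          ≤⟨ ∣N─T∪S∣+∣T∣+∣S∣≤∣N∣+1+degR G {T} x∈S ⟩
  ∣ N G x ∣ + 1 + d           ≤⟨ +-monoˡ-≤ d (+-monoˡ-≤ 1 (Δ x)) ⟩
  r + 1 + d                   ≡⟨ +-comm (r + 1) d ⟩
  d + (r + 1)                 ∎)
  where
  open ≤-Reasoning
  a = ∣ N G x ─ (T ∪ CommonNbhd G T) ∣
  t = ∣ T ∣
  d = degR G T x
  t≤r+1 : t ≤ r + 1
  t≤r+1 = ≤-trans (p⊆q⇒∣p∣≤∣q∣ (∈CommonNbhd⇒⊆N G {T} x∈S)) (≤-trans (Δ x) (m≤m+n r 1))
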